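{- Let $G$ and $H$ be graphs. If there exists a vertex $u\in V(G)$ with eccentricity $\varepsilon(u)\le 2$ and degree $\delta(u)=\alpha(\widehat{G})$, then $$\xi(G\odot H)=\beta(\widehat{G})\,\mathrm{n}(H)+\alpha(\widehat{G}).$$
   Context: All graphs are finite, simple and undirected; $\mathrm{n}(H)$ denotes the order of $H$, $\delta(u)$ the degree of $u$, and $\varepsilon(u)=\max_{x\in V(G)} d_G(u,x)$. For a connected graph $\Gamma$, a set $S\subseteq V(\Gamma)$ is a distance-equalizer set if for every two distinct $u,v\in V(\Gamma)\setminus S$ there is $w\in S$ with $d_\Gamma(w,u)=d_\Gamma(w,v)$; $\xi(\Gamma)$ is the minimum cardinality of such a set. For $V(G)=\{v_1,\dots,v_n\}$, the corona product $G\odot H$ is obtained from $G$ and $n$ pairwise disjoint copies $H_1,\dots,H_n$ of $H$ by joining $v_i$ to every vertex of $H_i$. The empty bisector graph $\widehat{G}$ has vertex set $V(G)$, with distinct $x,y$ adjacent iff there is no $w\in V(G)$ with $d_G(w,x)=d_G(w,y)$. $\alpha$ denotes the independence number and $\beta$ the vertex cover number. -}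

module Defs where

open import Data.Nat using (ℕ; zero; suc; _+_; _*_; _≤_; _<_)
open import Data.Fin using (Fin; splitAt; remQuot)
open import Data.Fin.Subset using (Subset; _∈_; _∉_; ∣_∣)
open import Data.Sum using (_⊎_; inj₁; inj₂)
open import Data.Product using (Σ; ∃; ∃-syntax; _×_; _,_)
open import Data.Empty using (⊥)
open import Relation.Nullary using (¬_)
open import Relation.Binary.PropositionalEquality using (_≡_; _≢_; refl; sym)
open import Function.Bundles using (_⇔_)

record Graph : Set₁ where
  field
    n      : ℕ
    adj    : Fin n → Fin n → Set
    adj-sym : ∀ {x y} → adj x y → adj y x
    adj-irrefl : ∀ {x} → ¬ adj x x
open Graph public

order : Graph → ℕ
order G = n G

data Walk (G : Graph) : Fin (n G) → Fin (n G) → ℕ → Set where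
  nil  : ∀ {x} → Walk G x x 0
  cons : ∀ {x z y k} → adj G x z → Walk G z y k → Walk G x y (suc k)

Dist : (G : Graph) → Fin (n G) → Fin (n G) → ℕ → Set
Dist G x y k = Walk G x y k × (∀ j → j < k → ¬ Walk G x y j)

Equidistant : (G : Graph) → Fin (n G) → Fin (n G) → Fin (n G) → Set
Equidistant G w x y = ∃[ k ] (Dist G w x k × Dist G w y k)

EccLe : (G : Graph) → Fin (n G) → ℕ → Set
EccLe G u e = ∀ x → ∃[ k ] (k ≤ e × Dist G u x k)

Degree : (G : Graph) → Fin (n G) → ℕ → Set
Degree G u d = Σ (Subset (n G)) λ N → (∀ v → (v ∈ N) ⇔ adj G u v) × ∣ N ∣ ≡ d

IsDistEqualizer : (G : Graph) → Subset (n G) → Set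
IsDistEqualizer G S =
  ∀ x y → x ≢ y → x ∉ S → y ∉ S → ∃[ w ] (w ∈ S × Equidistant G w x y)

IsXi : Graph → ℕ → Set
IsXi G k = Σ (Subset (n G)) (λ S → IsDistEqualizer G S × ∣ S ∣ ≡ k)
         × (∀ S → IsDistEqualizer G S → k ≤ ∣ S ∣)

IsIndependent : (G : Graph) → Subset (n G) → Set
IsIndependent G S = ∀ x y → x ∈ S → y ∈ S → ¬ adj G x y

IsAlpha : Graph → ℕ → Set
IsAlpha G k = Σ (Subset (n G)) (λ S → IsIndependent G S × ∣ S ∣ ≡ k)
            × (∀ S → IsIndependent G S → ∣ S ∣ ≤ k)

IsVertexCover : (G : Graph) → Subset (n G) → Set
IsVertexCover G S = ∀ x y → adj G x y → x ∈ S ⊎ y ∈ S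

IsBeta : Graph → ℕ → Set
IsBeta G k = Σ (Subset (n G)) (λ S → IsVertexCover G S × ∣ S ∣ ≡ k)
           × (∀ S → IsVertexCover G S → k ≤ ∣ S ∣)

bisAdj : (G : Graph) → Fin (n G) → Fin (n G) → Set
bisAdj G x y = x ≢ y × ¬ (∃[ w ] Equidistant G w x y)

emptyBisector : Graph → Graph
emptyBisector G = record
  { n = n G
  ; adj = bisAdj G
  ; adj-sym = λ { (x≢y , ne) → (λ e → x≢y (sym e))
                         , (λ { (w , k , d1 , d2) → ne (w , k , d2 , d1) }) }
  ; adj-irrefl = λ { (x≢x , _) → x≢x refl }
  }

-- corona product: vertices Fin (n + n * m); the first n are V(G) = {v_i},
-- vertex (i , h) of Fin n × Fin m (via remQuot) is h in copy H_i.
CVert : ℕ → ℕ → Set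
CVert a b = Fin a ⊎ (Fin a × Fin b)

decode : ∀ a b → Fin (a + a * b) → CVert a b
decode a b x with splitAt a x
... | inj₁ i = inj₁ i
... | inj₂ j = inj₂ (remQuot b j)

cAdj : (G H : Graph) → CVert (n G) (n H) → CVert (n G) (n H) → Set
cAdj G H (inj₁ a) (inj₁ b) = adj G a b
cAdj G H (inj₁ a) (inj₂ (i , h)) = a ≡ i
cAdj G H (inj₂ (i , h)) (inj₁ a) = i ≡ a
cAdj G H (inj₂ (i , h)) (inj₂ (j , h')) = i ≡ j × adj H h h'

cSym : (G H : Graph) → ∀ x y → cAdj G H x y → cAdj G H y x
cSym G H (inj₁ a) (inj₁ b) e = adj-sym G e
cSym G H (inj₁ a) (inj₂ _) e = sym e
cSym G H (inj₂ _) (inj₁ a) e = sym e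
cSym G H (inj₂ _) (inj₂ _) (e , a) = sym e , adj-sym H a

cIrr : (G H : Graph) → ∀ x → ¬ cAdj G H x x
cIrr G H (inj₁ a) e = adj-irrefl G e
cIrr G H (inj₂ _) (_ , e) = adj-irrefl H e

corona : Graph → Graph → Graph
corona G H = record
  { n = n G + n G * n H
  ; adj = λ x y → cAdj G H (decode (n G) (n H) x) (decode (n G) (n H) y)
  ; adj-sym = λ {x} {y} → cSym G H (decode (n G) (n H) x) (decode (n G) (n H) y)
  ; adj-irrefl = λ {x} → cIrr G H (decode (n G) (n H) x)
  }

module Submission where

-- Write base p for the vertex of G that a vertex p of G ⊙ H lies over, and level p for 0 on
-- G and 1 on the copies of H.  When base p ≠ base q every shortest walk leaves the fibre of p
-- through base p and enters that of q through base q, so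
-- d(p, q) = level p + d_G(base p, base q) + level q.
--
-- Lower bound: a vertex equidistant from vertices of distinct copies H_i, H_j must lie over
-- a vertex of G equidistant from i and j, so the copies not contained in a distance-equalizer
-- set S are indexed by an independent set of Ĝ and S contains at least β(Ĝ) whole copies;
-- and v_i can only be equalized with a vertex of H_i from inside its own fibre, so S meets
-- every fibre.  Hence |S| ≥ n(G) + β(Ĝ)(n(H) − 1) = β(Ĝ) n(H) + α(Ĝ), by α + β = n (Gallai).
--
-- Upper bound: with N the neighbourhood of u, take N together with every copy H_i, i ∉ N;
-- it has α(Ĝ) + β(Ĝ) n(H) vertices.  The vertices outside it are u, the vertices at distance
-- 2 from u and the copies over N; a vertex of H_u is at distance 3 from all of them but u, and
-- u is equalized with each of them by a neighbour of u in N.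

open import Defs
open import Data.Nat
  using (ℕ; zero; suc; _+_; _*_; _∸_; _≤_; _<_; _≥_; z≤n; s≤s; z<s; pred; >-nonZero)
open import Data.Nat.Properties
open import Data.Bool using (Bool; true; false)
open import Data.Fin as Fin using (Fin; zero; suc; splitAt; combine; _↑ˡ_; _↑ʳ_; fromℕ<)
open import Data.Fin.Properties
  using (splitAt-↑ˡ; splitAt-↑ʳ; splitAt⁻¹-↑ˡ; splitAt⁻¹-↑ʳ; remQuot-combine; combine-remQuot;
         all?; ¬∀⟶∃¬; nonZeroIndex)
open import Data.Fin.Subset using (Subset; _∈_; _∉_; ∁; ∣_∣)
open import Data.Fin.Subset.Properties
  using (∣p∣≤n; ∣∁p∣≡n∸∣p∣; x∈∁p⇒x∉p; x∉p⇒x∈∁p; x∉∁p⇒x∈p; _∈?_)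
open import Data.Vec using ([]; _∷_; lookup; tabulate)
open import Data.Vec.Properties using ([]=⇒lookup; lookup⇒[]=; lookup∘tabulate)
open import Data.Sum using (inj₁; inj₂)
import Data.Sum.Properties as Sum
import Data.Product.Properties as Product
open import Data.Product using (Σ; ∃-syntax; ∃₂; _×_; _,_; proj₂)
open import Data.Empty using (⊥-elim)
open import Function using (_∘_; _⇔_; Equivalence)
open import Relation.Nullary using (¬_; Dec; yes; no; does; contradiction)
open import Relation.Nullary.Decidable using (dec-true)
open import Relation.Binary using (DecidableEquality; tri<; tri≈; tri>)
open import Relation.Binary.PropositionalEquality
open import Algebra.Properties.CommutativeMonoid.Sum +-0-commutativeMonoid
  using (sum; sum-syntax; sum-cong-≗; ∑-distrib-+)
open import Algebra.Properties.Semiring.Sum +-*-semiring using (*-distribʳ-sum)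

boolToℕ : Bool → ℕ
boolToℕ true  = 1
boolToℕ false = 0

∑-const : ∀ n c → ∑[ i < n ] c ≡ n * c
∑-const zero    c = refl
∑-const (suc n) c = cong (c +_) (∑-const n c)

∑-mono-≤ : ∀ {n} {f g : Fin n → ℕ} → (∀ i → f i ≤ g i) → sum f ≤ sum g
∑-mono-≤ {zero}  f≤g = z≤n
∑-mono-≤ {suc n} f≤g = +-mono-≤ (f≤g zero) (∑-mono-≤ (f≤g ∘ suc))

≤-∑ : ∀ {n} (f : Fin n → ℕ) i → f i ≤ sum f
≤-∑ f zero    = m≤m+n _ _
≤-∑ f (suc i) = ≤-trans (≤-∑ (f ∘ suc) i) (m≤n+m _ _)

∑-↑ : ∀ m {n} (f : Fin (m + n) → ℕ) →
      sum f ≡ ∑[ i < m ] f (i ↑ˡ n) + ∑[ j < n ] f (m ↑ʳ j)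
∑-↑ zero    f = refl
∑-↑ (suc m) f = trans (cong (f zero +_) (∑-↑ m (f ∘ suc))) (sym (+-assoc (f zero) _ _))

∑-combine : ∀ m n (f : Fin (m * n) → ℕ) → sum f ≡ ∑[ i < m ] ∑[ j < n ] f (combine i j)
∑-combine zero    n f = refl
∑-combine (suc m) n f =
  trans (∑-↑ n f) (cong (∑[ j < n ] f (j ↑ˡ (m * n)) +_) (∑-combine m n (f ∘ (n ↑ʳ_))))

∣p∣≡∑ : ∀ {n} (p : Subset n) → ∣ p ∣ ≡ ∑[ i < n ] boolToℕ (lookup p i)
∣p∣≡∑ []          = refl
∣p∣≡∑ (true ∷ p)  = cong suc (∣p∣≡∑ p)
∣p∣≡∑ (false ∷ p) = ∣p∣≡∑ p

module _ (Γ : Graph) where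

  adj⇒≢ : ∀ {x y} → adj Γ x y → x ≢ y
  adj⇒≢ x~y refl = adj-irrefl Γ x~y

  walk₀⇒≡ : ∀ {x y} → Walk Γ x y 0 → x ≡ y
  walk₀⇒≡ nil = refl

  dist-unique : ∀ {x y d₁ d₂} → Dist Γ x y d₁ → Dist Γ x y d₂ → d₁ ≡ d₂
  dist-unique {d₁ = d₁} {d₂} (w₁ , min₁) (w₂ , min₂) with <-cmp d₁ d₂
  ... | tri< d₁<d₂ _ _ = contradiction w₁ (min₂ d₁ d₁<d₂)
  ... | tri≈ _ d₁≡d₂ _ = d₁≡d₂
  ... | tri> _ _ d₂<d₁ = contradiction w₂ (min₁ d₂ d₂<d₁)

  adj⇒dist₁ : ∀ {x y} → adj Γ x y → Dist Γ x y 1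
  adj⇒dist₁ x~y = cons x~y nil , λ { zero _ w → adj⇒≢ x~y (walk₀⇒≡ w) ; (suc _) (s≤s ()) _ }

  eccLe₂⇒dist₂ : ∀ {u v} → EccLe Γ u 2 → u ≢ v → ¬ adj Γ u v → Dist Γ u v 2
  eccLe₂⇒dist₂ {u} {v} ecc u≢v u≁v with ecc v
  ... | 0 , _ , (w , _)          = contradiction (walk₀⇒≡ w) u≢v
  ... | 1 , _ , (cons u~z w , _) = contradiction (subst (adj Γ u) (walk₀⇒≡ w) u~z) u≁v
  ... | 2 , _ , u-v              = u-v
  ... | suc (suc (suc _)) , s≤s (s≤s ()) , _

  ∁-independent⇒cover : ∀ {I} → IsIndependent Γ I → IsVertexCover Γ (∁ I)
  ∁-independent⇒cover {I} I-ind x y x~y with x ∈? I | y ∈? I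
  ... | no x∉I  | _       = inj₁ (x∉p⇒x∈∁p x∉I)
  ... | yes _   | no y∉I  = inj₂ (x∉p⇒x∈∁p y∉I)
  ... | yes x∈I | yes y∈I = contradiction x~y (I-ind x y x∈I y∈I)

  ∁-cover⇒independent : ∀ {C} → IsVertexCover Γ C → IsIndependent Γ (∁ C)
  ∁-cover⇒independent C-cov x y x∈∁C y∈∁C x~y with C-cov x y x~y
  ... | inj₁ x∈C = x∈∁p⇒x∉p x∈∁C x∈C
  ... | inj₂ y∈C = x∈∁p⇒x∉p y∈∁C y∈C

  α+β≡n : ∀ {a b} → IsAlpha Γ a → IsBeta Γ b → a + b ≡ n Γ
  α+β≡n {a} {b} ((I , I-ind , ∣I∣≡a) , α-max) ((C , C-cov , ∣C∣≡b) , β-min) =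
    ≤-antisym a+b≤n n≤a+b
    where
    ∣∁I∣≡n∸a : ∣ ∁ I ∣ ≡ n Γ ∸ a
    ∣∁I∣≡n∸a = trans (∣∁p∣≡n∸∣p∣ I) (cong (n Γ ∸_) ∣I∣≡a)

    ∣∁C∣≡n∸b : ∣ ∁ C ∣ ≡ n Γ ∸ b
    ∣∁C∣≡n∸b = trans (∣∁p∣≡n∸∣p∣ C) (cong (n Γ ∸_) ∣C∣≡b)

    a+b≤n : a + b ≤ n Γ
    a+b≤n = begin
      a + b           ≤⟨ +-monoʳ-≤ a (β-min (∁ I) (∁-independent⇒cover I-ind)) ⟩
      a + ∣ ∁ I ∣     ≡⟨ cong (a +_) ∣∁I∣≡n∸a ⟩
      a + (n Γ ∸ a)   ≡⟨ m+[n∸m]≡n (subst (_≤ n Γ) ∣I∣≡a (∣p∣≤n I)) ⟩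
      n Γ             ∎
      where open ≤-Reasoning

    n≤a+b : n Γ ≤ a + b
    n≤a+b = begin
      n Γ             ≤⟨ m≤n+m∸n (n Γ) b ⟩
      b + (n Γ ∸ b)   ≡⟨ cong (b +_) (sym ∣∁C∣≡n∸b) ⟩
      b + ∣ ∁ C ∣     ≤⟨ +-monoʳ-≤ b (α-max (∁ C) (∁-cover⇒independent C-cov)) ⟩
      b + a           ≡⟨ +-comm b a ⟩
      a + b           ∎
      where open ≤-Reasoning

module Corona (G H : Graph) where

  V : Set
  V = CVert (n G) (n H)

  _≟ᵥ_ : DecidableEquality V
  _≟ᵥ_ = Sum.≡-dec Fin._≟_ (Product.≡-dec Fin._≟_ Fin._≟_)

  dec : Fin (n (corona G H)) → V
  dec = decode (n G) (n H)

  encode : V → Fin (n (corona G H))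
  encode (inj₁ i)       = i ↑ˡ (n G * n H)
  encode (inj₂ (i , h)) = n G ↑ʳ combine i h

  dec∘encode : ∀ p → dec (encode p) ≡ p
  dec∘encode (inj₁ i) rewrite splitAt-↑ˡ (n G) i (n G * n H) = refl
  dec∘encode (inj₂ (i , h)) rewrite splitAt-↑ʳ (n G) (n G * n H) (combine i h)
                                  | remQuot-combine {n G} {n H} i h = refl

  encode∘dec : ∀ x → encode (dec x) ≡ x
  encode∘dec x with splitAt (n G) x in eq
  ... | inj₁ i = splitAt⁻¹-↑ˡ eq
  ... | inj₂ j = trans (cong (n G ↑ʳ_) (combine-remQuot {n G} (n H) j)) (splitAt⁻¹-↑ʳ eq)

  encode-injective : ∀ {p q} → encode p ≡ encode q → p ≡ q
  encode-injective {p} {q} e = trans (sym (dec∘encode p)) (trans (cong dec e) (dec∘encode q))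

  dec-injective : ∀ {x y} → dec x ≡ dec y → x ≡ y
  dec-injective {x} {y} e = trans (sym (encode∘dec x)) (trans (cong encode e) (encode∘dec y))

  -- Walks of G ⊙ H restated on the decoded vertices, so that steps can be analysed by
  -- pattern matching on cAdj.
  data CWalk : V → V → ℕ → Set where
    nil  : ∀ {p} → CWalk p p 0
    cons : ∀ {p r q k} → cAdj G H p r → CWalk r q k → CWalk p q (suc k)

  CDist : V → V → ℕ → Set
  CDist p q k = CWalk p q k × (∀ j → j < k → ¬ CWalk p q j)

  CEquidistant : V → V → V → Set
  CEquidistant r p q = ∃[ k ] (CDist r p k × CDist r q k)

  CEquidistant-sym : ∀ {r p q} → CEquidistant r p q → CEquidistant r q p
  CEquidistant-sym (k , r-p , r-q) = k , r-q , r-p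

  cwalk₀⇒≡ : ∀ {p q} → CWalk p q 0 → p ≡ q
  cwalk₀⇒≡ nil = refl

  cadj⇒cdist₁ : ∀ {p q} → cAdj G H p q → CDist p q 1
  cadj⇒cdist₁ {p} {q} p~q =
    cons p~q nil ,
    λ { zero _ w → cIrr G H q (subst (λ s → cAdj G H s q) (cwalk₀⇒≡ w) p~q) ; (suc _) (s≤s ()) _ }

  walk⇒cwalk : ∀ {x y k} → Walk (corona G H) x y k → CWalk (dec x) (dec y) k
  walk⇒cwalk nil          = nil
  walk⇒cwalk (cons x~z w) = cons x~z (walk⇒cwalk w)

  cwalk⇒walk : ∀ {p q k} → CWalk p q k → Walk (corona G H) (encode p) (encode q) k
  cwalk⇒walk nil = nil
  cwalk⇒walk {p} (cons {r = r} p~r w) =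
    cons (subst₂ (cAdj G H) (sym (dec∘encode p)) (sym (dec∘encode r)) p~r) (cwalk⇒walk w)

  cdist⇒dist : ∀ {p q k} → CDist p q k → Dist (corona G H) (encode p) (encode q) k
  cdist⇒dist {p} {q} (w , min) =
    cwalk⇒walk w ,
    λ j j<k w′ → min j j<k
      (subst₂ (λ s t → CWalk s t j) (dec∘encode p) (dec∘encode q) (walk⇒cwalk w′))

  dist⇒cdist : ∀ {x y k} → Dist (corona G H) x y k → CDist (dec x) (dec y) k
  dist⇒cdist {x} {y} (w , min) =
    walk⇒cwalk w ,
    λ j j<k w′ → min j j<k
      (subst₂ (λ s t → Walk (corona G H) s t j) (encode∘dec x) (encode∘dec y) (cwalk⇒walk w′))

  IsCEqualizer : Subset (n (corona G H)) → Set
  IsCEqualizer S = ∀ p q → p ≢ q → encode p ∉ S → encode q ∉ S →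
                   ∃[ r ] (encode r ∈ S × CEquidistant r p q)

  isCEqualizer⇒isDistEqualizer : ∀ {S} → IsCEqualizer S → IsDistEqualizer (corona G H) S
  isCEqualizer⇒isDistEqualizer {S} S-eq x y x≢y x∉S y∉S
    with S-eq (dec x) (dec y) (x≢y ∘ dec-injective)
              (x∉S ∘ subst (_∈ S) (encode∘dec x)) (y∉S ∘ subst (_∈ S) (encode∘dec y))
  ... | r , r∈S , k , r-x , r-y =
    encode r , r∈S , k , transport x (cdist⇒dist r-x) , transport y (cdist⇒dist r-y)
    where
    transport : ∀ z → Dist (corona G H) (encode r) (encode (dec z)) k →
                Dist (corona G H) (encode r) z k
    transport z = subst (λ t → Dist (corona G H) (encode r) t k) (encode∘dec z)

  isDistEqualizer⇒isCEqualizer : ∀ {S} → IsDistEqualizer (corona G H) S → IsCEqualizer S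
  isDistEqualizer⇒isCEqualizer {S} S-eq p q p≢q p∉S q∉S
    with S-eq (encode p) (encode q) (p≢q ∘ encode-injective) p∉S q∉S
  ... | w , w∈S , k , w-p , w-q =
    dec w , subst (_∈ S) (sym (encode∘dec w)) w∈S , k ,
    transport p (dist⇒cdist w-p) , transport q (dist⇒cdist w-q)
    where
    transport : ∀ s → CDist (dec w) (dec (encode s)) k → CDist (dec w) s k
    transport s = subst (λ t → CDist (dec w) t k) (dec∘encode s)

  base : V → Fin (n G)
  base (inj₁ i)       = i
  base (inj₂ (i , _)) = i

  level : V → ℕ
  level (inj₁ _) = 0
  level (inj₂ _) = 1

  lift-from-base : ∀ {a j} q → Walk G a (base q) j → CWalk (inj₁ a) q (j + level q)
  lift-from-base (inj₁ _) nil         = nil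
  lift-from-base (inj₂ _) nil         = cons refl nil
  lift-from-base q        (cons a~z w) = cons a~z (lift-from-base q w)

  lift : ∀ {j} p q → Walk G (base p) (base q) j → CWalk p q (level p + j + level q)
  lift (inj₁ _) q w = lift-from-base q w
  lift (inj₂ _) q w = cons refl (lift-from-base q w)

  level≤length : ∀ {k} q → CWalk (inj₁ (base q)) q k → level q ≤ k
  level≤length (inj₁ _) _          = z≤n
  level≤length (inj₂ _) (cons _ _) = s≤s z≤n

  project : ∀ {p q k} → CWalk p q k → base p ≢ base q →
            ∃[ j ] (Walk G (base p) (base q) j × level p + j + level q ≤ k)
  project nil p≢q = contradiction refl p≢q
  project {inj₁ a} {q} (cons {r = inj₁ b} a~b w) a≢q with b Fin.≟ base q
  ... | yes refl = 1 , cons a~b nil , s≤s (level≤length q w)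
  ... | no b≢q   = let j , w′ , j≤ = project w b≢q in suc j , cons a~b w′ , s≤s j≤
  project {inj₁ _} (cons {r = inj₂ _} refl w) p≢q =
    let j , w′ , j≤ = project w p≢q in j , w′ , m≤n⇒m≤1+n (<⇒≤ j≤)
  project {inj₂ _} (cons {r = inj₁ _} refl w) p≢q =
    let j , w′ , j≤ = project w p≢q in j , w′ , s≤s j≤
  project {inj₂ _} (cons {r = inj₂ _} (refl , _) w) p≢q =
    let j , w′ , j≤ = project w p≢q in j , w′ , m≤n⇒m≤1+n j≤

  dist-lift : ∀ {p q d} → base p ≢ base q → Dist G (base p) (base q) d →
              CDist p q (level p + d + level q)
  dist-lift {p} {q} {d} p≢q (w , min) = lift p q w , λ j j<k w′ →
    let j′ , w″ , j′≤j = project w′ p≢q in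
    min j′ (+-cancelˡ-< (level p) j′ d
             (+-cancelʳ-< (level q) (level p + j′) (level p + d) (≤-<-trans j′≤j j<k))) w″

  dist-project : ∀ {p q k} → base p ≢ base q → CDist p q k →
                 ∃[ d ] (Dist G (base p) (base q) d × k ≡ level p + d + level q)
  dist-project {p} {q} p≢q (w , min) =
    let j , w′ , j≤k = project w p≢q in
    j , (w′ , λ i i<j w″ → min _ (<-≤-trans (+-monoˡ-< (level q) (+-monoʳ-< (level p) i<j)) j≤k)
                                 (lift p q w″)) ,
    ≤-antisym (≮⇒≥ (λ k<j → min _ k<j (lift p q w′))) j≤k

  CEquidistant⇒dist-levels : ∀ {r p q} → base r ≢ base p → base r ≢ base q → CEquidistant r p q →
    ∃₂ λ d₁ d₂ → Dist G (base r) (base p) d₁ × Dist G (base r) (base q) d₂ ×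
                 d₁ + level p ≡ d₂ + level q
  CEquidistant⇒dist-levels {r} {p} {q} r≢p r≢q (k , r-p , r-q)
    with dist-project r≢p r-p | dist-project r≢q r-q
  ... | d₁ , G₁ , k≡₁ | d₂ , G₂ , k≡₂ = d₁ , d₂ , G₁ , G₂ , +-cancelˡ-≡ (level r) _ _ (begin
    level r + (d₁ + level p) ≡⟨ +-assoc (level r) d₁ (level p) ⟨
    level r + d₁ + level p   ≡⟨ trans (sym k≡₁) k≡₂ ⟩
    level r + d₂ + level q   ≡⟨ +-assoc (level r) d₂ (level q) ⟩
    level r + (d₂ + level q) ∎)
    where open ≡-Reasoning

  ¬CEquidistant-own-fibre : ∀ {r p q} → base r ≡ base p → base r ≢ base q → level p ≤ level q →
                            ¬ CEquidistant r p q
  ¬CEquidistant-own-fibre {r} {p} {q} r≡p r≢q ℓp≤ℓq (k , (_ , min) , r-q) with dist-project r≢q r-q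
  ... | zero  , (w , _) , _ = r≢q (walk₀⇒≡ G w)
  ... | suc d , _ , k≡ = min _ shorter (lift r p (subst (λ z → Walk G (base r) z 0) r≡p nil))
    where
    open ≤-Reasoning
    shorter : level r + 0 + level p < k
    shorter = begin-strict
      level r + 0 + level p     ≤⟨ +-monoʳ-≤ (level r + 0) ℓp≤ℓq ⟩
      level r + 0 + level q     <⟨ +-monoˡ-< (level q) (+-monoʳ-< (level r) z<s) ⟩
      level r + suc d + level q ≡⟨ k≡ ⟨
      k                         ∎

  CEquidistant-base-copy⇒base≡ : ∀ {r i h} → CEquidistant r (inj₁ i) (inj₂ (i , h)) → base r ≡ i
  CEquidistant-base-copy⇒base≡ {r} {i} eq with base r Fin.≟ i
  ... | yes r≡i = r≡i
  ... | no r≢i with CEquidistant⇒dist-levels r≢i r≢i eq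
  ...   | d₁ , d₂ , G₁ , G₂ , d₁+0≡d₂+1 =
    contradiction (+-cancelˡ-≡ d₂ 0 1 (subst (λ d → d + 0 ≡ d₂ + 1) (dist-unique G G₁ G₂) d₁+0≡d₂+1))
                  λ ()

  CEquidistant-copies⇒Equidistant : ∀ {r i j h h′} → i ≢ j →
    CEquidistant r (inj₂ (i , h)) (inj₂ (j , h′)) → Equidistant G (base r) i j
  CEquidistant-copies⇒Equidistant {r} {i} {j} i≢j eq with base r Fin.≟ i | base r Fin.≟ j
  ... | yes r≡i | _ =
    ⊥-elim (¬CEquidistant-own-fibre r≡i (i≢j ∘ trans (sym r≡i)) ≤-refl eq)
  ... | no r≢i | yes r≡j =
    ⊥-elim (¬CEquidistant-own-fibre r≡j (λ r≡i → i≢j (trans (sym r≡i) r≡j)) ≤-refl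
                                    (CEquidistant-sym eq))
  ... | no r≢i | no r≢j with CEquidistant⇒dist-levels r≢i r≢j eq
  ...   | d₁ , d₂ , G₁ , G₂ , d₁+1≡d₂+1 =
    d₁ , G₁ , subst (Dist G (base r) j) (sym (+-cancelʳ-≡ 1 d₁ d₂ d₁+1≡d₂+1)) G₂

  fibreSize : Subset (n (corona G H)) → Fin (n G) → ℕ
  fibreSize S i = boolToℕ (lookup S (encode (inj₁ i)))
                + ∑[ h < n H ] boolToℕ (lookup S (encode (inj₂ (i , h))))

  ∣S∣≡∑fibreSize : ∀ S → ∣ S ∣ ≡ ∑[ i < n G ] fibreSize S i
  ∣S∣≡∑fibreSize S = begin
    ∣ S ∣
      ≡⟨ ∣p∣≡∑ S ⟩
    sum χ
      ≡⟨ ∑-↑ (n G) χ ⟩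
    ∑[ i < n G ] χ (encode (inj₁ i)) + sum (χ ∘ (n G ↑ʳ_))
      ≡⟨ cong (∑[ i < n G ] χ (encode (inj₁ i)) +_) (∑-combine (n G) (n H) (χ ∘ (n G ↑ʳ_))) ⟩
    ∑[ i < n G ] χ (encode (inj₁ i)) + ∑[ i < n G ] ∑[ h < n H ] χ (encode (inj₂ (i , h)))
      ≡⟨ ∑-distrib-+ (χ ∘ encode ∘ inj₁) (λ i → ∑[ h < n H ] χ (encode (inj₂ (i , h)))) ⟨
    ∑[ i < n G ] fibreSize S i ∎
    where
    open ≡-Reasoning
    χ : Fin (n (corona G H)) → ℕ
    χ = boolToℕ ∘ lookup S

  fibreSize-pos : ∀ {S} p → encode p ∈ S → 1 ≤ fibreSize S (base p)
  fibreSize-pos {S} (inj₁ i) p∈S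
    rewrite []=⇒lookup p∈S = s≤s z≤n
  fibreSize-pos {S} (inj₂ (i , h)) p∈S =
    ≤-trans (≤-trans (≤-reflexive (cong boolToℕ (sym ([]=⇒lookup p∈S)))) (≤-∑ _ h)) (m≤n+m _ _)

  fibreSize-full : ∀ {S i} → (∀ h → encode (inj₂ (i , h)) ∈ S) → n H ≤ fibreSize S i
  fibreSize-full {S} {i} full = ≤-trans (≤-reflexive (sym copy-count)) (m≤n+m _ _)
    where
    copy-count : ∑[ h < n H ] boolToℕ (lookup S (encode (inj₂ (i , h)))) ≡ n H
    copy-count = trans (sum-cong-≗ (cong boolToℕ ∘ []=⇒lookup ∘ full))
                   (trans (∑-const (n H) 1) (*-identityʳ (n H)))

  module UpperBound {u : Fin (n G)} (N : Subset (n G)) (N⇔adj : ∀ v → v ∈ N ⇔ adj G u v)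
                    (ecc : EccLe G u 2) (h₀ : Fin (n H)) where

    inS₀ : V → Bool
    inS₀ (inj₁ i)       = lookup N i
    inS₀ (inj₂ (i , _)) = lookup (∁ N) i

    S₀ : Subset (n (corona G H))
    S₀ = tabulate (inS₀ ∘ dec)

    lookup-S₀ : ∀ p → lookup S₀ (encode p) ≡ inS₀ p
    lookup-S₀ p = trans (lookup∘tabulate (inS₀ ∘ dec) (encode p)) (cong inS₀ (dec∘encode p))

    inS₀⇒∈S₀ : ∀ p → inS₀ p ≡ true → encode p ∈ S₀
    inS₀⇒∈S₀ p e = lookup⇒[]= (encode p) S₀ (trans (lookup-S₀ p) e)

    adj⇒∈S₀ : ∀ {i} → adj G u i → encode (inj₁ i) ∈ S₀
    adj⇒∈S₀ {i} u~i = inS₀⇒∈S₀ (inj₁ i) ([]=⇒lookup (Equivalence.from (N⇔adj i) u~i))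

    ∉S₀⇒≁ : ∀ {a} → encode (inj₁ a) ∉ S₀ → ¬ adj G u a
    ∉S₀⇒≁ a∉S₀ = a∉S₀ ∘ adj⇒∈S₀

    ∉S₀⇒adj : ∀ {i h} → encode (inj₂ (i , h)) ∉ S₀ → adj G u i
    ∉S₀⇒adj {i} {h} ih∉S₀ =
      Equivalence.to (N⇔adj i) (x∉∁p⇒x∈p (ih∉S₀ ∘ inS₀⇒∈S₀ (inj₂ (i , h)) ∘ []=⇒lookup))

    w₀ : V
    w₀ = inj₂ (u , h₀)

    w₀∈S₀ : encode w₀ ∈ S₀
    w₀∈S₀ = inS₀⇒∈S₀ w₀ ([]=⇒lookup (x∉p⇒x∈∁p (adj-irrefl G ∘ Equivalence.to (N⇔adj u))))

    dist-w₀ : ∀ {p} → encode p ∉ S₀ → p ≢ inj₁ u → CDist w₀ p 3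
    dist-w₀ {inj₁ a} a∉S₀ a≢u = dist-lift u≢a (eccLe₂⇒dist₂ G ecc u≢a (∉S₀⇒≁ a∉S₀))
      where u≢a = a≢u ∘ cong inj₁ ∘ sym
    dist-w₀ {inj₂ _} ih∉S₀ _ = dist-lift (adj⇒≢ G u~i) (adj⇒dist₁ G u~i)
      where u~i = ∉S₀⇒adj ih∉S₀

    CEqualizer-of-u : ∀ {q} → encode q ∉ S₀ → q ≢ inj₁ u →
                      ∃[ r ] (encode r ∈ S₀ × CEquidistant r (inj₁ u) q)
    CEqualizer-of-u {inj₁ b} b∉S₀ b≢u
      with eccLe₂⇒dist₂ G ecc (b≢u ∘ cong inj₁ ∘ sym) (∉S₀⇒≁ b∉S₀)
    ... | cons u~k (cons k~b nil) , _ =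
      inj₁ _ , adj⇒∈S₀ u~k , 1 , cadj⇒cdist₁ (adj-sym G u~k) , cadj⇒cdist₁ k~b
    CEqualizer-of-u {inj₂ (i , h)} ih∉S₀ _ =
      inj₁ i , adj⇒∈S₀ u~i , 1 , cadj⇒cdist₁ (adj-sym G u~i) , cadj⇒cdist₁ refl
      where u~i = ∉S₀⇒adj ih∉S₀

    S₀-isCEqualizer : IsCEqualizer S₀
    S₀-isCEqualizer p q p≢q p∉S₀ q∉S₀ with p ≟ᵥ inj₁ u | q ≟ᵥ inj₁ u
    ... | yes refl | _        = CEqualizer-of-u q∉S₀ (p≢q ∘ sym)
    ... | no _     | yes refl =
      let r , r∈S₀ , eq = CEqualizer-of-u p∉S₀ p≢q in r , r∈S₀ , CEquidistant-sym eq
    ... | no p≢u   | no q≢u   = w₀ , w₀∈S₀ , 3 , dist-w₀ p∉S₀ p≢u , dist-w₀ q∉S₀ q≢u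

    ∣S₀∣ : ∣ S₀ ∣ ≡ ∣ N ∣ + ∣ ∁ N ∣ * n H
    ∣S₀∣ = begin
      ∣ S₀ ∣
        ≡⟨ ∣S∣≡∑fibreSize S₀ ⟩
      ∑[ i < n G ] fibreSize S₀ i
        ≡⟨ sum-cong-≗ fibreSize-S₀ ⟩
      ∑[ i < n G ] (χ N i + χ (∁ N) i * n H)
        ≡⟨ ∑-distrib-+ (χ N) (λ i → χ (∁ N) i * n H) ⟩
      sum (χ N) + ∑[ i < n G ] (χ (∁ N) i * n H)
        ≡⟨ cong (sum (χ N) +_) (*-distribʳ-sum (n H) (χ (∁ N))) ⟨
      sum (χ N) + sum (χ (∁ N)) * n H
        ≡⟨ cong₂ (λ s t → s + t * n H) (∣p∣≡∑ N) (∣p∣≡∑ (∁ N)) ⟨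
      ∣ N ∣ + ∣ ∁ N ∣ * n H ∎
      where
      open ≡-Reasoning
      χ : Subset (n G) → Fin (n G) → ℕ
      χ M = boolToℕ ∘ lookup M
      fibreSize-S₀ : ∀ i → fibreSize S₀ i ≡ χ N i + χ (∁ N) i * n H
      fibreSize-S₀ i =
        cong₂ _+_ (cong boolToℕ (lookup-S₀ (inj₁ i)))
                  (trans (sum-cong-≗ (λ h → cong boolToℕ (lookup-S₀ (inj₂ (i , h)))))
                         (trans (∑-const (n H) _) (*-comm (n H) _)))

  module LowerBound (S : Subset (n (corona G H))) (S-eq : IsDistEqualizer (corona G H) S)
                    (h₀ : Fin (n H)) where

    S-isCEqualizer : IsCEqualizer S
    S-isCEqualizer = isDistEqualizer⇒isCEqualizer S-eq

    fibre-meets-S : ∀ i → ∃[ p ] (base p ≡ i × encode p ∈ S)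
    fibre-meets-S i with encode (inj₁ i) ∈? S | encode (inj₂ (i , h₀)) ∈? S
    ... | yes i∈S | _         = inj₁ i , refl , i∈S
    ... | no _    | yes ih₀∈S = inj₂ (i , h₀) , refl , ih₀∈S
    ... | no i∉S  | no ih₀∉S
      with S-isCEqualizer (inj₁ i) (inj₂ (i , h₀)) (λ ()) i∉S ih₀∉S
    ...   | r , r∈S , eq = r , CEquidistant-base-copy⇒base≡ eq , r∈S

    full? : ∀ i → Dec (∀ h → encode (inj₂ (i , h)) ∈ S)
    full? i = all? (λ h → encode (inj₂ (i , h)) ∈? S)

    Full : Subset (n G)
    Full = tabulate (does ∘ full?)

    ∉Full⇒gap : ∀ {i} → i ∉ Full → ∃[ h ] (encode (inj₂ (i , h)) ∉ S)
    ∉Full⇒gap {i} i∉Full = ¬∀⟶∃¬ (n H) _ (λ h → encode (inj₂ (i , h)) ∈? S) λ full →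
      i∉Full (lookup⇒[]= i Full
               (trans (lookup∘tabulate (does ∘ full?) i) (dec-true (full? i) full)))

    Full-isVertexCover : IsVertexCover (emptyBisector G) Full
    Full-isVertexCover i j (i≢j , ¬equidistant) with i ∈? Full | j ∈? Full
    ... | yes i∈Full | _          = inj₁ i∈Full
    ... | no _       | yes j∈Full = inj₂ j∈Full
    ... | no i∉Full  | no j∉Full
      with ∉Full⇒gap i∉Full | ∉Full⇒gap j∉Full
    ...   | h , ih∉S | h′ , jh′∉S
      with S-isCEqualizer (inj₂ (i , h)) (inj₂ (j , h′)) (i≢j ∘ cong base) ih∉S jh′∉S
    ...     | r , _ , eq =
      contradiction (base r , CEquidistant-copies⇒Equidistant i≢j eq) ¬equidistant

    fibreSize≥ : ∀ i (full? : Dec (∀ h → encode (inj₂ (i , h)) ∈ S)) →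
                 1 + boolToℕ (does full?) * pred (n H) ≤ fibreSize S i
    fibreSize≥ i (yes full) = ≤-trans (≤-reflexive 1+m′≡m) (fibreSize-full full)
      where
      1+m′≡m : 1 + 1 * pred (n H) ≡ n H
      1+m′≡m = trans (cong suc (*-identityˡ _)) (suc-pred (n H) ⦃ nonZeroIndex h₀ ⦄)
    fibreSize≥ i (no _) =
      let p , p≡i , p∈S = fibre-meets-S i in
      subst (λ j → 1 ≤ fibreSize S j) p≡i (fibreSize-pos p p∈S)

    ∣S∣≥n+∣Full∣*pred[n[H]] : n G + ∣ Full ∣ * pred (n H) ≤ ∣ S ∣
    ∣S∣≥n+∣Full∣*pred[n[H]] = begin
      n G + ∣ Full ∣ * m′
        ≡⟨ cong₂ (λ s t → s + t * m′) (sym (trans (∑-const (n G) 1) (*-identityʳ (n G))))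
                 (∣p∣≡∑ Full) ⟩
      ∑[ i < n G ] 1 + sum (boolToℕ ∘ lookup Full) * m′
        ≡⟨ cong (∑[ i < n G ] 1 +_) (*-distribʳ-sum m′ (boolToℕ ∘ lookup Full)) ⟩
      ∑[ i < n G ] 1 + ∑[ i < n G ] (boolToℕ (lookup Full i) * m′)
        ≡⟨ ∑-distrib-+ (λ _ → 1) (λ i → boolToℕ (lookup Full i) * m′) ⟨
      ∑[ i < n G ] (1 + boolToℕ (lookup Full i) * m′)
        ≡⟨ sum-cong-≗ (λ i → cong (λ b → 1 + boolToℕ b * m′) (lookup∘tabulate (does ∘ full?) i)) ⟩
      ∑[ i < n G ] (1 + boolToℕ (does (full? i)) * m′)
        ≤⟨ ∑-mono-≤ (λ i → fibreSize≥ i (full? i)) ⟩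
      ∑[ i < n G ] fibreSize S i
        ≡⟨ ∣S∣≡∑fibreSize S ⟨
      ∣ S ∣ ∎
      where
      open ≤-Reasoning
      m′ = pred (n H)

ξ-upper-witness : ∀ (G H : Graph) {a b} → 1 ≤ n H →
  IsAlpha (emptyBisector G) a → IsBeta (emptyBisector G) b →
  ∃[ u ] (EccLe G u 2 × Degree G u a) →
  Σ (Subset (n (corona G H))) λ S → IsDistEqualizer (corona G H) S × ∣ S ∣ ≡ b * n H + a
ξ-upper-witness G H {a} {b} n[H]≥1 α β (u , ecc , N , N⇔adj , ∣N∣≡a) =
  S₀ , isCEqualizer⇒isDistEqualizer S₀-isCEqualizer , ∣S₀∣≡
  where
  open Corona G H
  open UpperBound N N⇔adj ecc (fromℕ< n[H]≥1)
  open ≡-Reasoning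

  ∣∁N∣≡b : ∣ ∁ N ∣ ≡ b
  ∣∁N∣≡b = begin
    ∣ ∁ N ∣        ≡⟨ ∣∁p∣≡n∸∣p∣ N ⟩
    n G ∸ ∣ N ∣    ≡⟨ cong₂ _∸_ (α+β≡n (emptyBisector G) α β) (sym ∣N∣≡a) ⟨
    a + b ∸ a      ≡⟨ m+n∸m≡n a b ⟩
    b              ∎

  ∣S₀∣≡ : ∣ S₀ ∣ ≡ b * n H + a
  ∣S₀∣≡ = begin
    ∣ S₀ ∣                 ≡⟨ ∣S₀∣ ⟩
    ∣ N ∣ + ∣ ∁ N ∣ * n H  ≡⟨ cong₂ (λ s t → s + t * n H) ∣N∣≡a ∣∁N∣≡b ⟩
    a + b * n H            ≡⟨ +-comm a (b * n H) ⟩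
    b * n H + a            ∎

ξ-lower-bound : ∀ (G H : Graph) {a b} → 1 ≤ n H →
  IsAlpha (emptyBisector G) a → IsBeta (emptyBisector G) b →
  ∀ S → IsDistEqualizer (corona G H) S → b * n H + a ≤ ∣ S ∣
ξ-lower-bound G H {a} {b} n[H]≥1 α β S S-eq = begin
  b * n H + a                 ≡⟨ cong (λ m → b * m + a) (suc-pred (n H) ⦃ >-nonZero n[H]≥1 ⦄) ⟨
  b * suc m′ + a              ≡⟨ cong (_+ a) (*-suc b m′) ⟩
  b + b * m′ + a              ≡⟨ +-comm (b + b * m′) a ⟩
  a + (b + b * m′)            ≡⟨ +-assoc a b (b * m′) ⟨
  a + b + b * m′              ≡⟨ cong (_+ b * m′) (α+β≡n (emptyBisector G) α β) ⟩
  n G + b * m′                ≤⟨ +-monoʳ-≤ (n G) (*-monoˡ-≤ m′ (proj₂ β Full Full-isVertexCover)) ⟩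
  n G + ∣ Full ∣ * m′         ≤⟨ ∣S∣≥n+∣Full∣*pred[n[H]] ⟩
  ∣ S ∣                       ∎
  where
  open Corona G H
  open LowerBound S S-eq (fromℕ< n[H]≥1)
  open ≤-Reasoning
  m′ = pred (n H)

proposition36 : (G H : Graph) → order H ≥ 1 → (a b : ℕ)
    → IsAlpha (emptyBisector G) a → IsBeta (emptyBisector G) b
    → (∃[ u ] (EccLe G u 2 × Degree G u a))
    → IsXi (corona G H) (b * order H + a)
proposition36 G H n[H]≥1 a b α β central =
  ξ-upper-witness G H n[H]≥1 α β central , ξ-lower-bound G H n[H]≥1 α β
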